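{- Let $(A,\to,1)$ be an algebra of type $(2,0)$ satisfying (Re), (M) and (Ex). Then (B) $\Leftrightarrow$ (BB) $\Leftrightarrow$ (*).
   Context: Properties, for all $x,y,z\in A$: (Re) $x\to x=1$; (M) $1\to x=x$; (Ex) $x\to(y\to z)=y\to(x\to z)$; (B) $(y\to z)\to[(x\to y)\to(x\to z)]=1$; (BB) $(y\to z)\to[(z\to x)\to(y\to x)]=1$; (*) $y\to z=1\Rightarrow (x\to y)\to(x\to z)=1$. -}

module Defs where

open import Level using (Level; suc)
open import Relation.Binary.PropositionalEquality using (_≡_)

record Algebra20 (a : Level) : Set (suc a) where
  field
    Carrier : Set a
    _⇒_     : Carrier → Carrier → Carrier
    𝟏       : Carrier
  infixr 5 _⇒_

module _ {a : Level} (𝔸 : Algebra20 a) where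
  open Algebra20 𝔸

  Re : Set a
  Re = ∀ x → x ⇒ x ≡ 𝟏

  M : Set a
  M = ∀ x → 𝟏 ⇒ x ≡ x

  Ex : Set a
  Ex = ∀ x y z → x ⇒ (y ⇒ z) ≡ y ⇒ (x ⇒ z)

  B : Set a
  B = ∀ x y z → (y ⇒ z) ⇒ ((x ⇒ y) ⇒ (x ⇒ z)) ≡ 𝟏

  BB : Set a
  BB = ∀ x y z → (y ⇒ z) ⇒ ((z ⇒ x) ⇒ (y ⇒ x)) ≡ 𝟏

  Star : Set a
  Star = ∀ x y z → y ⇒ z ≡ 𝟏 → (x ⇒ y) ⇒ (x ⇒ z) ≡ 𝟏

-- (B) and (BB) are exchanged by (Ex). (B) gives (*) because, by (M), the hypothesis
-- y → z = 1 may replace the leading 1 in 1 → ((x → y) → (x → z)). Conversely, (Re) and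
-- (Ex) give y → ((y → z) → z) = 1, which (*) turns into
-- (x → y) → (x → ((y → z) → z)) = 1, and two uses of (Ex) rearrange this into (B).
module Submission where

open import Defs
open import Level using (Level)
open import Data.Product using (_×_; _,_)
open import Function.Base using (_∘_)
open import Function.Bundles using (_⇔_; mk⇔)
open import Relation.Binary.PropositionalEquality using (_≡_; sym; cong; module ≡-Reasoning)

module _ {a : Level} (𝔸 : Algebra20 a) where
  open Algebra20 𝔸
  open ≡-Reasoning

  B⇒BB : Ex 𝔸 → B 𝔸 → BB 𝔸
  B⇒BB ex b x y z = begin
    (y ⇒ z) ⇒ ((z ⇒ x) ⇒ (y ⇒ x)) ≡⟨ ex (y ⇒ z) (z ⇒ x) (y ⇒ x) ⟩
    (z ⇒ x) ⇒ ((y ⇒ z) ⇒ (y ⇒ x)) ≡⟨ b y z x ⟩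
    𝟏                             ∎

  BB⇒B : Ex 𝔸 → BB 𝔸 → B 𝔸
  BB⇒B ex bb x y z = begin
    (y ⇒ z) ⇒ ((x ⇒ y) ⇒ (x ⇒ z)) ≡⟨ ex (y ⇒ z) (x ⇒ y) (x ⇒ z) ⟩
    (x ⇒ y) ⇒ ((y ⇒ z) ⇒ (x ⇒ z)) ≡⟨ bb z x y ⟩
    𝟏                             ∎

  B⇒Star : M 𝔸 → B 𝔸 → Star 𝔸
  B⇒Star m b x y z y⇒z≡𝟏 = begin
    (x ⇒ y) ⇒ (x ⇒ z)             ≡⟨ sym (m _) ⟩
    𝟏 ⇒ ((x ⇒ y) ⇒ (x ⇒ z))       ≡⟨ cong (_⇒ ((x ⇒ y) ⇒ (x ⇒ z))) (sym y⇒z≡𝟏) ⟩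
    (y ⇒ z) ⇒ ((x ⇒ y) ⇒ (x ⇒ z)) ≡⟨ b x y z ⟩
    𝟏                             ∎

  x⇒[x⇒y]⇒y≡𝟏 : Re 𝔸 → Ex 𝔸 → ∀ x y → x ⇒ ((x ⇒ y) ⇒ y) ≡ 𝟏
  x⇒[x⇒y]⇒y≡𝟏 re ex x y = begin
    x ⇒ ((x ⇒ y) ⇒ y) ≡⟨ ex x (x ⇒ y) y ⟩
    (x ⇒ y) ⇒ (x ⇒ y) ≡⟨ re (x ⇒ y) ⟩
    𝟏                 ∎

  Star⇒B : Re 𝔸 → Ex 𝔸 → Star 𝔸 → B 𝔸
  Star⇒B re ex star x y z = begin
    (y ⇒ z) ⇒ ((x ⇒ y) ⇒ (x ⇒ z))   ≡⟨ ex (y ⇒ z) (x ⇒ y) (x ⇒ z) ⟩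
    (x ⇒ y) ⇒ ((y ⇒ z) ⇒ (x ⇒ z))   ≡⟨ cong ((x ⇒ y) ⇒_) (sym (ex x (y ⇒ z) z)) ⟩
    (x ⇒ y) ⇒ (x ⇒ ((y ⇒ z) ⇒ z))   ≡⟨ star x y ((y ⇒ z) ⇒ z) (x⇒[x⇒y]⇒y≡𝟏 re ex y z) ⟩
    𝟏                               ∎

theorem2p2 : {a : Level} (𝔸 : Algebra20 a) → Re 𝔸 → M 𝔸 → Ex 𝔸 →
    ((B 𝔸 ⇔ BB 𝔸) × (BB 𝔸 ⇔ Star 𝔸))
theorem2p2 𝔸 re m ex =
    mk⇔ (B⇒BB 𝔸 ex) (BB⇒B 𝔸 ex)
  , mk⇔ (B⇒Star 𝔸 m ∘ BB⇒B 𝔸 ex) (B⇒BB 𝔸 ex ∘ Star⇒B 𝔸 re ex)
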